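{- If $\vdash_0 P$, then $P$ is not divergent, i.e., there is no infinite sequence $P\longrightarrow P_1\longrightarrow P_2\longrightarrow\cdots$.
   Context: Asynchronous $\pi$-calculus: processes $P ::= a\langle\tilde b\rangle \mid\ !a(\tilde b).P \mid P|Q \mid (\nu a)P \mid G$, $G ::= \mathbf 0 \mid a(\tilde b).P \mid \tau.P \mid [a=b]G \mid G+G'$, well-sorted under a fixed sorting; $P\longrightarrow P'$ means $P\xrightarrow{\tau}P'$ in the standard early LTS of the asynchronous $\pi$-calculus. Names are partitioned into output-controlled ($x,y,z$) and input-controlled ($u,v,w$). Judgements $\vdash_\eta P$, $\eta\in\{0,1\}$: $\vdash_1 u(\tilde a).P$ if $\vdash_1P$; $\vdash_0 x(\tilde a).P$, $\vdash_0 !x(\tilde a).P$ if $\vdash_1P$; $\vdash_1x\langle\tilde a\rangle$; $\vdash_0u\langle\tilde a\rangle$; $\vdash_\eta(\nu a)P$ if $\vdash_\eta P$; $\vdash_0\mathbf0$; $\vdash_{\eta_1+\eta_2}P|Q$ if $\vdash_{\eta_1}P$, $\vdash_{\eta_2}Q$, $\eta_1+\eta_2\le1$; $\vdash_\eta G_1+G_2$ if $\vdash_\eta G_1,G_2$; $\vdash_\eta\tau.P$ if $\vdash_\eta P$; $\vdash_0[a=b]G$ if $\vdash_0G$. -}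

module Defs where

-- Asynchronous polyadic pi-calculus, intrinsically well-sorted, de Bruijn names,
-- with the standard early LTS and the type system |-_eta of the paper.

open import Data.Nat using (ℕ; zero; suc; _+_; _≤_)
open import Data.List using (List; []; _∷_; _++_)
open import Data.List.Relation.Unary.All using (All; []; _∷_)
import Data.List.Relation.Unary.All as All
open import Data.Product using (Σ; _×_; _,_)
open import Relation.Binary.PropositionalEquality using (_≡_)

-- output-controlled (x,y,z) / input-controlled (u,v,w)
data Ctrl : Set where
  outCtrl inCtrl : Ctrl

-- A sorting: sorts, the object sorts carried by a subject of each sort,
-- and the control class of names of each sort (the partition respects sorts).
record Sorting : Set₁ where
  field
    Sort : Set
    obj  : Sort → List Sort
    ctrl : Sort → Ctrl

module Pi (𝒮 : Sorting) where
  open Sorting 𝒮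

  Ctx : Set
  Ctx = List Sort

  data _∋_ : Ctx → Sort → Set where
    here  : ∀ {Γ s} → (s ∷ Γ) ∋ s
    there : ∀ {Γ s t} → Γ ∋ s → (t ∷ Γ) ∋ s

  Names : Ctx → List Sort → Set
  Names Γ ss = All (Γ ∋_) ss

  data Proc (Γ : Ctx) : Set
  data Guard (Γ : Ctx) : Set

  data Proc Γ where
    out : ∀ {s} → Γ ∋ s → Names Γ (obj s) → Proc Γ
    rep : ∀ {s} → Γ ∋ s → Proc (obj s ++ Γ) → Proc Γ
    _∣_ : Proc Γ → Proc Γ → Proc Γ
    ν   : (s : Sort) → Proc (s ∷ Γ) → Proc Γ
    grd : Guard Γ → Proc Γ

  data Guard Γ where
    nil   : Guard Γ
    inp   : ∀ {s} → Γ ∋ s → Proc (obj s ++ Γ) → Guard Γ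
    tau   : Proc Γ → Guard Γ
    match : ∀ {s} → Γ ∋ s → Γ ∋ s → Guard Γ → Guard Γ
    _⊕_   : Guard Γ → Guard Γ → Guard Γ

  Ren : Ctx → Ctx → Set
  Ren Γ Δ = ∀ {s} → Γ ∋ s → Δ ∋ s

  lift : ∀ {Γ Δ t} → Ren Γ Δ → Ren (t ∷ Γ) (t ∷ Δ)
  lift ρ here      = here
  lift ρ (there x) = there (ρ x)

  lift* : ∀ {Γ Δ} ss → Ren Γ Δ → Ren (ss ++ Γ) (ss ++ Δ)
  lift* []       ρ = ρ
  lift* (s ∷ ss) ρ = lift (lift* ss ρ)

  ren  : ∀ {Γ Δ} → Ren Γ Δ → Proc Γ → Proc Δ
  renG : ∀ {Γ Δ} → Ren Γ Δ → Guard Γ → Guard Δ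
  ren ρ (out a bs)      = out (ρ a) (All.map ρ bs)
  ren ρ (rep {s} a P)   = rep (ρ a) (ren (lift* (obj s) ρ) P)
  ren ρ (P ∣ Q)         = ren ρ P ∣ ren ρ Q
  ren ρ (ν s P)         = ν s (ren (lift ρ) P)
  ren ρ (grd G)         = grd (renG ρ G)
  renG ρ nil            = nil
  renG ρ (inp {s} a P)  = inp (ρ a) (ren (lift* (obj s) ρ) P)
  renG ρ (tau P)        = tau (ren ρ P)
  renG ρ (match a b G)  = match (ρ a) (ρ b) (renG ρ G)
  renG ρ (G ⊕ H)        = renG ρ G ⊕ renG ρ H

  inst : ∀ {Γ ss} → Names Γ ss → Ren (ss ++ Γ) Γ
  inst []       x         = x
  inst (c ∷ cs) here      = c
  inst (c ∷ cs) (there x) = inst cs x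

  -- extension of a context by extruded names Δ (innermost first)
  ext : Ctx → Ctx → Ctx
  ext []      Γ = Γ
  ext (s ∷ Δ) Γ = ext Δ (s ∷ Γ)

  wkExt : ∀ Δ {Γ} → Ren Γ (ext Δ Γ)
  wkExt []      x = x
  wkExt (s ∷ Δ) x = wkExt Δ (there x)

  liftExt : ∀ Δ {Γ Γ'} → Ren Γ Γ' → Ren (ext Δ Γ) (ext Δ Γ')
  liftExt []      ρ = ρ
  liftExt (s ∷ Δ) ρ = liftExt Δ (lift ρ)

  swap01 : ∀ {Γ s t} → Ren (t ∷ s ∷ Γ) (s ∷ t ∷ Γ)
  swap01 here              = there here
  swap01 (there here)      = here
  swap01 (there (there x)) = there (there x)

  sw : ∀ Δ {Γ s} → Ren (ext Δ (s ∷ Γ)) (s ∷ ext Δ Γ)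
  sw []      x = x
  sw (t ∷ Δ) x = sw Δ (liftExt Δ swap01 x)

  νExt : ∀ Δ {Γ} → Proc (ext Δ Γ) → Proc Γ
  νExt []      P = P
  νExt (s ∷ Δ) P = ν s (νExt Δ P)

  data _occursIn_ {Γ s} (x : Γ ∋ s) : ∀ {ss} → Names Γ ss → Set where
    hd : ∀ {ss} {bs : Names Γ ss} → x occursIn (x ∷ bs)
    tl : ∀ {t ss} {y : Γ ∋ t} {bs : Names Γ ss} → x occursIn bs → x occursIn (y ∷ bs)

  data Inp : ∀ {Γ s} → Proc Γ → Γ ∋ s → Names Γ (obj s) → Proc Γ → Set where
    inp-ax : ∀ {Γ s} {a : Γ ∋ s} {P cs} →
             Inp (grd (inp a P)) a cs (ren (inst cs) P)
    rep-ax : ∀ {Γ s} {a : Γ ∋ s} {P cs} →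
             Inp (rep a P) a cs (ren (inst cs) P ∣ rep a P)
    sumL   : ∀ {Γ s} {a : Γ ∋ s} {cs G H R} →
             Inp (grd G) a cs R → Inp (grd (G ⊕ H)) a cs R
    sumR   : ∀ {Γ s} {a : Γ ∋ s} {cs G H R} →
             Inp (grd H) a cs R → Inp (grd (G ⊕ H)) a cs R
    mat    : ∀ {Γ s t} {a : Γ ∋ s} {b : Γ ∋ t} {cs G R} →
             Inp (grd G) a cs R → Inp (grd (match b b G)) a cs R
    parL   : ∀ {Γ s} {a : Γ ∋ s} {cs P P' Q} →
             Inp P a cs P' → Inp (P ∣ Q) a cs (P' ∣ Q)
    parR   : ∀ {Γ s} {a : Γ ∋ s} {cs P Q Q'} →
             Inp Q a cs Q' → Inp (P ∣ Q) a cs (P ∣ Q')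
    res    : ∀ {Γ s t} {a : Γ ∋ s} {cs} {P P' : Proc (t ∷ Γ)} →
             Inp P (there a) (All.map there cs) P' → Inp (ν t P) a cs (ν t P')

  -- output transitions  P --(ν Δ) a⟨b̃⟩--> P'  (Δ = extruded names; [] = free output)
  data Out : ∀ {Γ s} → Proc Γ → (Δ : Ctx) → Γ ∋ s → Names (ext Δ Γ) (obj s) → Proc (ext Δ Γ) → Set where
    out-ax : ∀ {Γ s} {a : Γ ∋ s} {bs} →
             Out (out a bs) [] a bs (grd nil)
    parL   : ∀ {Γ s Δ} {a : Γ ∋ s} {bs P P' Q} →
             Out P Δ a bs P' → Out (P ∣ Q) Δ a bs (P' ∣ ren (wkExt Δ) Q)
    parR   : ∀ {Γ s Δ} {a : Γ ∋ s} {bs P Q Q'} →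
             Out Q Δ a bs Q' → Out (P ∣ Q) Δ a bs (ren (wkExt Δ) P ∣ Q')
    res    : ∀ {Γ s t Δ} {a : Γ ∋ s} {bs} {P : Proc (t ∷ Γ)} {P'} →
             Out P Δ (there a) (All.map (liftExt Δ there) bs) P' →
             Out (ν t P) Δ a bs (ν t (ren (sw Δ) P'))
    opn    : ∀ {Γ s t Δ} {a : Γ ∋ s} {P : Proc (t ∷ Γ)} {bs P'} →
             Out P Δ (there a) bs P' → wkExt Δ here occursIn bs →
             Out (ν t P) (t ∷ Δ) a bs P'

  infix 4 _⟶_
  data _⟶_ : ∀ {Γ} → Proc Γ → Proc Γ → Set where
    tau-ax : ∀ {Γ} {P : Proc Γ} → grd (tau P) ⟶ P
    sumL   : ∀ {Γ} {G H : Guard Γ} {R} → grd G ⟶ R → grd (G ⊕ H) ⟶ R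
    sumR   : ∀ {Γ} {G H : Guard Γ} {R} → grd H ⟶ R → grd (G ⊕ H) ⟶ R
    mat    : ∀ {Γ s} {b : Γ ∋ s} {G R} → grd G ⟶ R → grd (match b b G) ⟶ R
    parL   : ∀ {Γ} {P P' Q : Proc Γ} → P ⟶ P' → P ∣ Q ⟶ P' ∣ Q
    parR   : ∀ {Γ} {P Q Q' : Proc Γ} → Q ⟶ Q' → P ∣ Q ⟶ P ∣ Q'
    res    : ∀ {Γ t} {P P' : Proc (t ∷ Γ)} → P ⟶ P' → ν t P ⟶ ν t P'
    comL   : ∀ {Γ s Δ} {a : Γ ∋ s} {bs} {P Q : Proc Γ} {P' Q'} →
             Out P Δ a bs P' → Inp (ren (wkExt Δ) Q) (wkExt Δ a) bs Q' →
             P ∣ Q ⟶ νExt Δ (P' ∣ Q')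
    comR   : ∀ {Γ s Δ} {a : Γ ∋ s} {bs} {P Q : Proc Γ} {P' Q'} →
             Inp (ren (wkExt Δ) P) (wkExt Δ a) bs P' → Out Q Δ a bs Q' →
             P ∣ Q ⟶ νExt Δ (P' ∣ Q')

  -- the type system  ⊢_η P  (η ∈ {0,1}; only these values are derivable)
  data ⊢[_]_  : ∀ {Γ} → ℕ → Proc Γ → Set
  data ⊢G[_]_ : ∀ {Γ} → ℕ → Guard Γ → Set

  data ⊢[_]_ where
    out-x : ∀ {Γ s} {a : Γ ∋ s} {bs} → ctrl s ≡ outCtrl → ⊢[ 1 ] out a bs
    out-u : ∀ {Γ s} {a : Γ ∋ s} {bs} → ctrl s ≡ inCtrl → ⊢[ 0 ] out a bs
    rep-x : ∀ {Γ s} {a : Γ ∋ s} {P} → ctrl s ≡ outCtrl → ⊢[ 1 ] P → ⊢[ 0 ] rep a P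
    par   : ∀ {Γ η₁ η₂} {P Q : Proc Γ} → ⊢[ η₁ ] P → ⊢[ η₂ ] Q → η₁ + η₂ ≤ 1 →
            ⊢[ η₁ + η₂ ] (P ∣ Q)
    res   : ∀ {Γ η t} {P : Proc (t ∷ Γ)} → ⊢[ η ] P → ⊢[ η ] ν t P
    guard : ∀ {Γ η} {G : Guard Γ} → ⊢G[ η ] G → ⊢[ η ] grd G

  data ⊢G[_]_ where
    nil   : ∀ {Γ} → ⊢G[ 0 ] (nil {Γ})
    inp-u : ∀ {Γ s} {a : Γ ∋ s} {P} → ctrl s ≡ inCtrl → ⊢[ 1 ] P → ⊢G[ 1 ] inp a P
    inp-x : ∀ {Γ s} {a : Γ ∋ s} {P} → ctrl s ≡ outCtrl → ⊢[ 1 ] P → ⊢G[ 0 ] inp a P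
    sum   : ∀ {Γ η} {G H : Guard Γ} → ⊢G[ η ] G → ⊢G[ η ] H → ⊢G[ η ] (G ⊕ H)
    tau   : ∀ {Γ η} {P : Proc Γ} → ⊢[ η ] P → ⊢G[ η ] tau P
    match : ∀ {Γ s} {a b : Γ ∋ s} {G} → ⊢G[ 0 ] G → ⊢G[ 0 ] match a b G

  Divergent : ∀ {Γ} → Proc Γ → Set
  Divergent {Γ} P = Σ (ℕ → Proc Γ) λ f → (f 0 ≡ P) × (∀ n → f n ⟶ f (suc n))

{-# OPTIONS --safe #-}
module Submission where

-- A ⊢₀ process cannot communicate: its inputs are all on output-controlled
-- names and its outputs all on input-controlled ones. So every τ-step of it
-- just consumes a τ-prefix, resolving sums and matches on the way; such a step
-- preserves ⊢₀ and strictly decreases the number of τ-prefixes that are not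
-- under an input or replication prefix, which therefore bounds the length of
-- every reduction sequence.

open import Defs
open import Data.Nat using (ℕ; zero; suc; _+_; _<_; z≤n)
open import Data.Nat.Properties using (≤-refl; <-≤-trans; m≤m+n; m≤n+m; +-monoˡ-<; +-monoʳ-<)
open import Data.Nat.Induction using (<-wellFounded)
open import Data.Product using (_×_; _,_; proj₁; proj₂)
open import Data.Empty using (⊥; ⊥-elim)
open import Function using (_∘_; _on_)
open import Induction.InfiniteDescent using (Descent; descent∧wf⇒empty)
import Relation.Binary.Construct.On as On
open import Relation.Binary.PropositionalEquality using (_≡_; _≢_; refl; sym; trans)
open import Relation.Nullary using (¬_)

module NonDivergence (𝒮 : Sorting) where
  open Sorting 𝒮
  open Pi 𝒮

  #τ  : ∀ {Γ} → Proc Γ → ℕ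
  #τG : ∀ {Γ} → Guard Γ → ℕ
  #τ (out a bs)    = 0
  #τ (rep a P)     = 0
  #τ (P ∣ Q)       = #τ P + #τ Q
  #τ (ν s P)       = #τ P
  #τ (grd G)       = #τG G
  #τG nil           = 0
  #τG (inp a P)     = 0
  #τG (tau P)       = suc (#τ P)
  #τG (match a b G) = #τG G
  #τG (G ⊕ H)       = #τG G + #τG H

  ⊢-ren  : ∀ {Γ Δ η} (ρ : Ren Γ Δ) {P : Proc Γ} → ⊢[ η ] P → ⊢[ η ] ren ρ P
  ⊢G-ren : ∀ {Γ Δ η} (ρ : Ren Γ Δ) {G : Guard Γ} → ⊢G[ η ] G → ⊢G[ η ] renG ρ G
  ⊢-ren ρ (out-x e)           = out-x e
  ⊢-ren ρ (out-u e)           = out-u e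
  ⊢-ren ρ (rep-x {s = s} e p) = rep-x e (⊢-ren (lift* (obj s) ρ) p)
  ⊢-ren ρ (par p q le)        = par (⊢-ren ρ p) (⊢-ren ρ q) le
  ⊢-ren ρ (res p)             = res (⊢-ren (lift ρ) p)
  ⊢-ren ρ (guard g)           = guard (⊢G-ren ρ g)
  ⊢G-ren ρ nil                 = nil
  ⊢G-ren ρ (inp-u {s = s} e p) = inp-u e (⊢-ren (lift* (obj s) ρ) p)
  ⊢G-ren ρ (inp-x {s = s} e p) = inp-x e (⊢-ren (lift* (obj s) ρ) p)
  ⊢G-ren ρ (sum g h)           = sum (⊢G-ren ρ g) (⊢G-ren ρ h)
  ⊢G-ren ρ (tau p)             = tau (⊢-ren ρ p)
  ⊢G-ren ρ (match g)           = match (⊢G-ren ρ g)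

  ⊢₀-∣⁻ : ∀ {Γ} {P Q : Proc Γ} → ⊢[ 0 ] (P ∣ Q) → ⊢[ 0 ] P × ⊢[ 0 ] Q
  ⊢₀-∣⁻ t = split t refl
    where
    split : ∀ {Γ η} {P Q : Proc Γ} → ⊢[ η ] (P ∣ Q) → η ≡ 0 → ⊢[ 0 ] P × ⊢[ 0 ] Q
    split (par {η₁ = zero} {η₂ = zero} p q _) refl = p , q

  ⊢₀-inp⇒outCtrl : ∀ {Γ s} {Q : Proc Γ} {a : Γ ∋ s} {cs Q'} →
                   ⊢[ 0 ] Q → Inp Q a cs Q' → ctrl s ≡ outCtrl
  ⊢₀-inp⇒outCtrl (guard (inp-x e _)) inp-ax   = e
  ⊢₀-inp⇒outCtrl (rep-x e _)         rep-ax   = e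
  ⊢₀-inp⇒outCtrl (guard (sum g _))   (sumL i) = ⊢₀-inp⇒outCtrl (guard g) i
  ⊢₀-inp⇒outCtrl (guard (sum _ h))   (sumR i) = ⊢₀-inp⇒outCtrl (guard h) i
  ⊢₀-inp⇒outCtrl (guard (match g))   (mat i)  = ⊢₀-inp⇒outCtrl (guard g) i
  ⊢₀-inp⇒outCtrl t                   (parL i) = ⊢₀-inp⇒outCtrl (⊢₀-∣⁻ t .proj₁) i
  ⊢₀-inp⇒outCtrl t                   (parR i) = ⊢₀-inp⇒outCtrl (⊢₀-∣⁻ t .proj₂) i
  ⊢₀-inp⇒outCtrl (res p)             (res i)  = ⊢₀-inp⇒outCtrl p i

  ⊢₀-out⇒inCtrl : ∀ {Γ s Δ} {P : Proc Γ} {a : Γ ∋ s} {bs P'} →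
                  ⊢[ 0 ] P → Out P Δ a bs P' → ctrl s ≡ inCtrl
  ⊢₀-out⇒inCtrl (out-u e) out-ax    = e
  ⊢₀-out⇒inCtrl t         (parL o)  = ⊢₀-out⇒inCtrl (⊢₀-∣⁻ t .proj₁) o
  ⊢₀-out⇒inCtrl t         (parR o)  = ⊢₀-out⇒inCtrl (⊢₀-∣⁻ t .proj₂) o
  ⊢₀-out⇒inCtrl (res p)   (res o)   = ⊢₀-out⇒inCtrl p o
  ⊢₀-out⇒inCtrl (res p)   (opn o _) = ⊢₀-out⇒inCtrl p o

  inCtrl≢outCtrl : inCtrl ≢ outCtrl
  inCtrl≢outCtrl ()

  ⊢₀-out-inp-⊥ : ∀ {Γ₁ Γ₂ s Δ} {P : Proc Γ₁} {Q : Proc Γ₂} {a : Γ₁ ∋ s} {b : Γ₂ ∋ s} {bs cs P' Q'} →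
                 ⊢[ 0 ] P → ⊢[ 0 ] Q → Out P Δ a bs P' → Inp Q b cs Q' → ⊥
  ⊢₀-out-inp-⊥ p q o i = inCtrl≢outCtrl (trans (sym (⊢₀-out⇒inCtrl p o)) (⊢₀-inp⇒outCtrl q i))

  ⊢₀-guard-⟶ : ∀ {Γ} {G : Guard Γ} {R} → ⊢G[ 0 ] G → grd G ⟶ R → ⊢[ 0 ] R × #τ R < #τG G
  ⊢₀-guard-⟶ (tau p) tau-ax = p , ≤-refl
  ⊢₀-guard-⟶ (sum {G = G} {H = H} g _) (sumL r) with ⊢₀-guard-⟶ g r
  ... | t , lt = t , <-≤-trans lt (m≤m+n (#τG G) (#τG H))
  ⊢₀-guard-⟶ (sum {G = G} {H = H} _ h) (sumR r) with ⊢₀-guard-⟶ h r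
  ... | t , lt = t , <-≤-trans lt (m≤n+m (#τG H) (#τG G))
  ⊢₀-guard-⟶ (match g) (mat r) = ⊢₀-guard-⟶ g r

  ⊢₀-⟶ : ∀ {Γ} {P P' : Proc Γ} → ⊢[ 0 ] P → P ⟶ P' → ⊢[ 0 ] P' × #τ P' < #τ P
  ⊢₀-⟶ t (parL {Q = Q} r) with ⊢₀-∣⁻ t
  ... | p , q with ⊢₀-⟶ p r
  ... | p' , lt = par p' q z≤n , +-monoˡ-< (#τ Q) lt
  ⊢₀-⟶ t (parR {P = P} r) with ⊢₀-∣⁻ t
  ... | p , q with ⊢₀-⟶ q r
  ... | q' , lt = par p q' z≤n , +-monoʳ-< (#τ P) lt
  ⊢₀-⟶ (res p) (res r) with ⊢₀-⟶ p r
  ... | p' , lt = res p' , lt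
  ⊢₀-⟶ t (comL o i) with ⊢₀-∣⁻ t
  ... | p , q = ⊥-elim (⊢₀-out-inp-⊥ p (⊢-ren _ q) o i)
  ⊢₀-⟶ t (comR i o) with ⊢₀-∣⁻ t
  ... | p , q = ⊥-elim (⊢₀-out-inp-⊥ q (⊢-ren _ p) o i)
  ⊢₀-⟶ (guard g) r = ⊢₀-guard-⟶ g r

  ⊢₀-divergent-descent : ∀ {Γ} → Descent (_<_ on #τ) (λ (P : Proc Γ) → ⊢[ 0 ] P × Divergent P)
  ⊢₀-divergent-descent (t , f , refl , steps) with ⊢₀-⟶ t (steps 0)
  ... | t₁ , lt = f 1 , lt , t₁ , f ∘ suc , refl , steps ∘ suc

  ⊢₀⇒¬Divergent : ∀ {Γ} (P : Proc Γ) → ⊢[ 0 ] P → ¬ Divergent P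
  ⊢₀⇒¬Divergent P t div =
    descent∧wf⇒empty ⊢₀-divergent-descent (On.wellFounded #τ <-wellFounded) P (t , div)

mainTheorem6 : (𝒮 : Sorting) → let open Pi 𝒮 in
    ∀ {Γ : Ctx} (P : Proc Γ) → ⊢[ 0 ] P → ¬ Divergent P
mainTheorem6 𝒮 = NonDivergence.⊢₀⇒¬Divergent 𝒮
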